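{- (i) For every integer $t \ge 0$, there is a unique binary LCD $[6t+4,2,4t+2]$ code $C$ with $d(C^\perp) \ge 2$, up to equivalence. (ii) For every integer $t \ge 1$, there are exactly two inequivalent binary LCD $[6t+5,2,4t+2]$ codes $C$ with $d(C^\perp) \ge 2$.
   Context: All codes are binary linear codes; an $[n,k,d]$ code is a $k$-dimensional subspace of $\mathbb{F}_2^n$ with minimum nonzero Hamming weight $d$, and $d(D)$ denotes the minimum nonzero weight of a code $D$. A code $C$ is LCD if $C \cap C^\perp = \{\mathbf{0}_n\}$, where $C^\perp$ is the dual with respect to the standard inner product. Two binary codes are equivalent if one is obtained from the other by a permutation of coordinates. -}

module Defs where

open import Data.Nat using (ℕ; zero; suc; _+_; _≤_)
open import Data.Bool using (Bool; true; false; _xor_; _∧_)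
open import Data.Vec using (Vec; []; _∷_; replicate; zipWith; foldr; lookup; tabulate; count)
open import Data.Product using (Σ; ∃; _×_; _,_)
open import Data.Fin.Permutation using (Permutation′; _⟨$⟩ʳ_)
open import Relation.Binary.PropositionalEquality using (_≡_; _≢_)
open import Relation.Nullary using (¬_)
open import Function.Bundles using (_⇔_)
open import Data.Bool.Properties using (T?)

Word : ℕ → Set
Word n = Vec Bool n

0w : ∀ {n} → Word n
0w {n} = replicate n false

_⊕_ : ∀ {n} → Word n → Word n → Word n
_⊕_ = zipWith _xor_

_·ᵥ_ : ∀ {n} → Bool → Word n → Word n
true  ·ᵥ x = x
false ·ᵥ x = 0w

wt : ∀ {n} → Word n → ℕ
wt = count T?

_∙_ : ∀ {n} → Word n → Word n → Bool
x ∙ y = foldr _ _xor_ false (zipWith _∧_ x y)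

lincomb : ∀ {n k} → Vec Bool k → Vec (Word n) k → Word n
lincomb []       []       = 0w
lincomb (c ∷ cs) (g ∷ gs) = (c ·ᵥ g) ⊕ lincomb cs gs

Code : ℕ → Set₁
Code n = Word n → Set

LinIndep : ∀ {n k} → Vec (Word n) k → Set
LinIndep {n} {k} G = ∀ (c : Vec Bool k) → lincomb c G ≡ 0w → c ≡ replicate k false

IsLinearCode : (n k : ℕ) → Code n → Set
IsLinearCode n k C =
  Σ (Vec (Word n) k) λ G → LinIndep G × (∀ x → C x ⇔ (∃ λ c → lincomb c G ≡ x))

Dual : ∀ {n} → Code n → Code n
Dual C x = ∀ y → C y → x ∙ y ≡ false

MinDist : ∀ {n} → Code n → ℕ → Set
MinDist C d =
  (∃ λ x → C x × x ≢ 0w × wt x ≡ d) × (∀ x → C x → x ≢ 0w → d ≤ wt x)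

-- d(C) ≥ d : every nonzero codeword has weight ≥ d
-- (vacuous for the zero code, matching the usual convention d({0}) = ∞)
MinDistAtLeast : ∀ {n} → Code n → ℕ → Set
MinDistAtLeast C d = ∀ x → C x → x ≢ 0w → d ≤ wt x

IsLCD : ∀ {n} → Code n → Set
IsLCD C = ∀ x → C x → Dual C x → x ≡ 0w

IsCode : (n k d : ℕ) → Code n → Set
IsCode n k d C = IsLinearCode n k C × MinDist C d

permute : ∀ {n} → Permutation′ n → Word n → Word n
permute σ x = tabulate (λ i → lookup x (σ ⟨$⟩ʳ i))

Equivalent : ∀ {n} → Code n → Code n → Set
Equivalent {n} C D = Σ (Permutation′ n) λ σ → ∀ x → C x ⇔ D (permute σ x)

GoodLCD : (n k d : ℕ) → Code n → Set
GoodLCD n k d C = IsCode n k d C × IsLCD C × MinDistAtLeast (Dual C) 2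

module Submission where

-- Take a basis g₁, g₂ of a binary [n,2] code and let a, b, c count the columns
-- (1,0), (0,1), (1,1) of the generator matrix; the nonzero codewords g₁, g₂, g₁ + g₂ then have
-- weights a + c, b + c, a + b. The dual distance is ≥ 2 iff there is no zero column, so
-- a + b + c = n, and the code is LCD iff its Gram matrix is nonsingular over 𝔽₂, i.e. iff at
-- least two of a, b, c are odd. Two codes with the same column counts differ by a coordinate
-- permutation, and the basis change (g₁ , g₂) ↦ (g₂ , g₁ + g₂) rotates (a , b , c).
-- The weight bounds confine a, b, c to a window of width K above an even m (m = 2t, K = 2 for
-- n = 6t + 4; m = 2t − 2, K = 5 for n = 6t + 5); after subtracting m the remaining cases are
-- checked exhaustively. They leave the single profile (2t+2, 2t+1, 2t+1), respectively the two
-- profiles (2t−1, 2t+3, 2t+3) and (2t+3, 2t+1, 2t+1), which differ in their maximal weight.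

open import Defs
open import Algebra.Bundles using (CommutativeRing)
open import Data.Bool using (Bool; true; false; not; _∧_; _xor_)
open import Data.Bool.Properties
  using ( not-involutive; not-distribˡ-xor; xor-comm; xor-assoc; xor-identityˡ; xor-identityʳ; xor-same
        ; ∧-comm; ∧-distribˡ-xor; ∧-zeroʳ; xor-∧-commutativeRing )
  renaming (_≟_ to _≟ᵇ_)
open import Algebra.Properties.CommutativeSemigroup
  (CommutativeRing.+-commutativeSemigroup xor-∧-commutativeRing) using (interchange)
open import Data.Empty using (⊥-elim)
open import Data.Fin using (Fin; zero; suc; punchIn)
open import Data.Fin.Permutation using (Permutation′; _⟨$⟩ʳ_; _⟨$⟩ˡ_; inverseʳ)
import Data.Fin.Permutation as Perm
open import Data.Nat using (ℕ; zero; suc; _+_; _*_; _≤_; _<_; _≟_; _≤?_; z≤n; s≤s)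
open import Data.Nat.Properties
  using ( +-suc; suc-injective; +-cancelˡ-≡; +-cancelˡ-≤; +-cancelʳ-≤; +-monoʳ-≤; +-mono-≤; +-monoʳ-<
        ; ≤-refl; ≤-reflexive; ≤-trans; <-≤-trans; <-irrefl; <⇒≱; ≮⇒≥; n≤1+n; m≤m+n; m≤n+m
        ; n≤0⇒n≡0; n≢0⇒n>0; m≤n⇒∃[o]m+o≡n; allUpTo?; +-0-commutativeMonoid )
open import Algebra.Properties.CommutativeMonoid.Sum +-0-commutativeMonoid using (sum; sum-permute)
open import Data.Nat.Tactic.RingSolver using (solve-∀)
open import Data.Product using (Σ; ∃; ∃₂; _×_; _,_; proj₁; proj₂)
import Data.Product as Product
open import Data.Product.Properties using (≡-dec; ,-injectiveˡ; ,-injectiveʳ)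
open import Data.Sum using (_⊎_; inj₁; inj₂)
import Data.Sum as Sum
open import Data.Vec using (Vec; []; _∷_; zipWith; lookup; tabulate; map; count; removeAt)
open import Data.Vec.Properties
  using ( zipWith-identityˡ; zipWith-identityʳ; zipWith-comm; zipWith-assoc; lookup-zipWith; lookup-replicate
        ; lookup∘tabulate; tabulate∘lookup; tabulate-cong; insertAt-punchIn; insertAt-removeAt )
open import Function using (_∘_; id)
open import Function.Bundles using (_⇔_; mk⇔; Equivalence)
open Equivalence using (to; from)
open import Level using (0ℓ)
open import Relation.Binary.Definitions using (DecidableEquality)
open import Relation.Binary.PropositionalEquality
open import Relation.Nullary using (¬_; Dec; yes; no; does)
open import Relation.Nullary.Decidable
  using (dec-true; True; toWitness; from-yes; _×-dec_; _⊎-dec_; _→-dec_)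
open import Relation.Unary using (Pred)
import Relation.Unary as U
open ≡-Reasoning

⊕-identityˡ : ∀ {n} (x : Word n) → 0w ⊕ x ≡ x
⊕-identityˡ = zipWith-identityˡ xor-identityˡ

⊕-identityʳ : ∀ {n} (x : Word n) → x ⊕ 0w ≡ x
⊕-identityʳ = zipWith-identityʳ xor-identityʳ

⊕-comm : ∀ {n} (x y : Word n) → x ⊕ y ≡ y ⊕ x
⊕-comm = zipWith-comm xor-comm

⊕-assoc : ∀ {n} (x y z : Word n) → (x ⊕ y) ⊕ z ≡ x ⊕ (y ⊕ z)
⊕-assoc = zipWith-assoc xor-assoc

⊕-self : ∀ {n} (x : Word n) → x ⊕ x ≡ 0w
⊕-self []      = refl
⊕-self (b ∷ x) = cong₂ _∷_ (xor-same b) (⊕-self x)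

⊕-cancelˡ : ∀ {n} (x y : Word n) → y ⊕ (x ⊕ y) ≡ x
⊕-cancelˡ x y = begin
  y ⊕ (x ⊕ y)  ≡⟨ cong (y ⊕_) (⊕-comm x y) ⟩
  y ⊕ (y ⊕ x)  ≡⟨ ⊕-assoc y y x ⟨
  (y ⊕ y) ⊕ x  ≡⟨ cong (_⊕ x) (⊕-self y) ⟩
  0w ⊕ x       ≡⟨ ⊕-identityˡ x ⟩
  x            ∎

∙-comm : ∀ {n} (x y : Word n) → x ∙ y ≡ y ∙ x
∙-comm []      []      = refl
∙-comm (a ∷ x) (b ∷ y) = cong₂ _xor_ (∧-comm a b) (∙-comm x y)

∙-zeroˡ : ∀ {n} (x : Word n) → 0w ∙ x ≡ false
∙-zeroˡ []      = refl
∙-zeroˡ (_ ∷ x) = ∙-zeroˡ x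

∙-zeroʳ : ∀ {n} (x : Word n) → x ∙ 0w ≡ false
∙-zeroʳ []      = refl
∙-zeroʳ (a ∷ x) = cong₂ _xor_ (∧-zeroʳ a) (∙-zeroʳ x)

∙-distribˡ-⊕ : ∀ {n} (x y z : Word n) → x ∙ (y ⊕ z) ≡ (x ∙ y) xor (x ∙ z)
∙-distribˡ-⊕ []      []      []      = refl
∙-distribˡ-⊕ (a ∷ x) (b ∷ y) (c ∷ z) =
  trans (cong₂ _xor_ (∧-distribˡ-xor a b c) (∙-distribˡ-⊕ x y z))
        (interchange (a ∧ b) (a ∧ c) (x ∙ y) (x ∙ z))

odd : ℕ → Bool
odd zero    = false
odd (suc n) = not (odd n)

odd-+ : ∀ m n → odd (m + n) ≡ odd m xor odd n
odd-+ zero    n = refl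
odd-+ (suc m) n = trans (cong not (odd-+ m n)) (not-distribˡ-xor (odd m) (odd n))

∙-self : ∀ {n} (x : Word n) → x ∙ x ≡ odd (wt x)
∙-self []        = refl
∙-self (false ∷ x) = ∙-self x
∙-self (true  ∷ x) = cong not (∙-self x)

unit∙ : ∀ {n} a (g : Word n) → (true ∷ 0w) ∙ (a ∷ g) ≡ a
unit∙ a g = trans (cong (a xor_) (∙-zeroˡ g)) (xor-identityʳ a)

wt-0w : ∀ n → wt (0w {n}) ≡ 0
wt-0w zero    = refl
wt-0w (suc n) = wt-0w n

wt≡0⇒0w : ∀ {n} (x : Word n) → wt x ≡ 0 → x ≡ 0w
wt≡0⇒0w []          _  = refl
wt≡0⇒0w (false ∷ x) eq = cong (false ∷_) (wt≡0⇒0w x eq)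

0<wt⇒≢0w : ∀ {n} {x : Word n} → 0 < wt x → x ≢ 0w
0<wt⇒≢0w {n} pos refl = <-irrefl (sym (wt-0w n)) pos

≢0w⇒0<wt : ∀ {n} {x : Word n} → x ≢ 0w → 0 < wt x
≢0w⇒0<wt {x = x} x≢0 = n≢0⇒n>0 (x≢0 ∘ wt≡0⇒0w x)

-- Coordinate permutations

lookup-extensionality : ∀ {A : Set} {n} {x y : Vec A n} → (∀ i → lookup x i ≡ lookup y i) → x ≡ y
lookup-extensionality {x = x} {y} eq =
  trans (sym (tabulate∘lookup x)) (trans (tabulate-cong eq) (tabulate∘lookup y))

lookup-permute : ∀ {n} (σ : Permutation′ n) (x : Word n) i → lookup (permute σ x) i ≡ lookup x (σ ⟨$⟩ʳ i)
lookup-permute σ x = lookup∘tabulate _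

permute-⊕ : ∀ {n} (σ : Permutation′ n) (x y : Word n) → permute σ (x ⊕ y) ≡ permute σ x ⊕ permute σ y
permute-⊕ σ x y = lookup-extensionality λ i → begin
  lookup (permute σ (x ⊕ y)) i                     ≡⟨ lookup-permute σ (x ⊕ y) i ⟩
  lookup (x ⊕ y) (σ ⟨$⟩ʳ i)                        ≡⟨ lookup-zipWith _xor_ (σ ⟨$⟩ʳ i) x y ⟩
  lookup x (σ ⟨$⟩ʳ i) xor lookup y (σ ⟨$⟩ʳ i)      ≡⟨ cong₂ _xor_ (lookup-permute σ x i) (lookup-permute σ y i) ⟨
  lookup (permute σ x) i xor lookup (permute σ y) i ≡⟨ lookup-zipWith _xor_ i (permute σ x) (permute σ y) ⟨
  lookup (permute σ x ⊕ permute σ y) i              ∎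

permute-0w : ∀ {n} (σ : Permutation′ n) → permute σ 0w ≡ 0w
permute-0w {n} σ = lookup-extensionality λ i →
  trans (lookup-permute σ 0w i) (trans (lookup-replicate (σ ⟨$⟩ʳ i) false) (sym (lookup-replicate i false)))

permute-·ᵥ : ∀ {n} (σ : Permutation′ n) c (x : Word n) → permute σ (c ·ᵥ x) ≡ c ·ᵥ permute σ x
permute-·ᵥ σ true  x = refl
permute-·ᵥ σ false x = permute-0w σ

permute-lincomb : ∀ {n k} (σ : Permutation′ n) (cs : Vec Bool k) (gs : Vec (Word n) k) →
                  permute σ (lincomb cs gs) ≡ lincomb cs (map (permute σ) gs)
permute-lincomb σ []       []       = permute-0w σ
permute-lincomb σ (c ∷ cs) (g ∷ gs) =
  trans (permute-⊕ σ (c ·ᵥ g) (lincomb cs gs)) (cong₂ _⊕_ (permute-·ᵥ σ c g) (permute-lincomb σ cs gs))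

permute-injective : ∀ {n} (σ : Permutation′ n) {x y : Word n} → permute σ x ≡ permute σ y → x ≡ y
permute-injective σ {x} {y} eq = lookup-extensionality λ i → begin
  lookup x i                           ≡⟨ cong (lookup x) (inverseʳ σ) ⟨
  lookup x (σ ⟨$⟩ʳ (σ ⟨$⟩ˡ i))         ≡⟨ lookup-permute σ x (σ ⟨$⟩ˡ i) ⟨
  lookup (permute σ x) (σ ⟨$⟩ˡ i)      ≡⟨ cong (λ w → lookup w (σ ⟨$⟩ˡ i)) eq ⟩
  lookup (permute σ y) (σ ⟨$⟩ˡ i)      ≡⟨ lookup-permute σ y (σ ⟨$⟩ˡ i) ⟩
  lookup y (σ ⟨$⟩ʳ (σ ⟨$⟩ˡ i))         ≡⟨ cong (lookup y) (inverseʳ σ) ⟩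
  lookup y i                           ∎

indicator : Bool → ℕ
indicator true  = 1
indicator false = 0

wt-tabulate : ∀ {n} (f : Fin n → Bool) → wt (tabulate f) ≡ sum (λ i → indicator (f i))
wt-tabulate {zero}  f = refl
wt-tabulate {suc n} f with f zero
... | true  = cong suc (wt-tabulate (f ∘ suc))
... | false = wt-tabulate (f ∘ suc)

wt-permute : ∀ {n} (σ : Permutation′ n) (x : Word n) → wt (permute σ x) ≡ wt x
wt-permute σ x = begin
  wt (permute σ x)                             ≡⟨ wt-tabulate (λ i → lookup x (σ ⟨$⟩ʳ i)) ⟩
  sum (λ i → indicator (lookup x (σ ⟨$⟩ʳ i)))  ≡⟨ sum-permute (λ i → indicator (lookup x i)) σ ⟨
  sum (λ i → indicator (lookup x i))           ≡⟨ wt-tabulate (lookup x) ⟨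
  wt (tabulate (lookup x))                     ≡⟨ cong wt (tabulate∘lookup x) ⟩
  wt x                                         ∎

module _ {A : Set} {P : Pred A 0ℓ} (P? : U.Decidable P) where

  count-swap : ∀ {n} x y (v : Vec A n) → count P? (x ∷ y ∷ v) ≡ count P? (y ∷ x ∷ v)
  count-swap x y v with does (P? x) | does (P? y)
  ... | true  | true  = refl
  ... | true  | false = refl
  ... | false | true  = refl
  ... | false | false = refl

  count-∷-cancel : ∀ {n} x (u v : Vec A n) → count P? (x ∷ u) ≡ count P? (x ∷ v) → count P? u ≡ count P? v
  count-∷-cancel x u v eq with does (P? x)
  ... | true  = suc-injective eq
  ... | false = eq

  count-∷-cong : ∀ {n} x (u v : Vec A n) → count P? u ≡ count P? v → count P? (x ∷ u) ≡ count P? (x ∷ v)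
  count-∷-cong x u v eq with does (P? x)
  ... | true  = cong suc eq
  ... | false = eq

  count-≤-∷ : ∀ {n} x (v : Vec A n) → count P? v ≤ count P? (x ∷ v)
  count-≤-∷ x v with does (P? x)
  ... | true  = n≤1+n _
  ... | false = ≤-refl

  count-removeAt : ∀ {n} (v : Vec A (suc n)) j → count P? (lookup v j ∷ removeAt v j) ≡ count P? v
  count-removeAt (x ∷ v)     zero    = refl
  count-removeAt (x ∷ y ∷ v) (suc j) =
    trans (count-swap (lookup (y ∷ v) j) x (removeAt (y ∷ v) j))
          (count-∷-cong x (lookup (y ∷ v) j ∷ removeAt (y ∷ v) j) (y ∷ v) (count-removeAt (y ∷ v) j))

lookup-removeAt : ∀ {A : Set} {n} (v : Vec A (suc n)) j k → lookup (removeAt v j) k ≡ lookup v (punchIn j k)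
lookup-removeAt v j k =
  trans (sym (insertAt-punchIn (removeAt v j) j (lookup v j) k))
        (cong (λ w → lookup w (punchIn j k)) (insertAt-removeAt v j))

insert-lookup : ∀ {A : Set} {n} (u : Vec A (suc n)) (v : Vec A n) {y} j (σ : Permutation′ n) → lookup u j ≡ y →
                (∀ i → lookup v i ≡ lookup (removeAt u j) (σ ⟨$⟩ʳ i)) →
                ∀ i → lookup (y ∷ v) i ≡ lookup u (Perm.insert zero j σ ⟨$⟩ʳ i)
insert-lookup u v j σ uj≡y σ-ok zero    = sym uj≡y
insert-lookup u v j σ uj≡y σ-ok (suc i) = begin
  lookup v i                                  ≡⟨ σ-ok i ⟩
  lookup (removeAt u j) (σ ⟨$⟩ʳ i)            ≡⟨ lookup-removeAt u j (σ ⟨$⟩ʳ i) ⟩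
  lookup u (punchIn j (σ ⟨$⟩ʳ i))             ≡⟨ cong (lookup u) (Perm.insert-punchIn zero j σ i) ⟨
  lookup u (Perm.insert zero j σ ⟨$⟩ʳ suc i)  ∎

module _ {A : Set} (_≟_ : DecidableEquality A) where

  count-here : ∀ {n} a (v : Vec A n) → 0 < count (a ≟_) (a ∷ v)
  count-here a v rewrite dec-true (a ≟ a) refl = s≤s z≤n

  lookup-from-count : ∀ {n} a (v : Vec A n) → 0 < count (a ≟_) v → ∃ λ j → lookup v j ≡ a
  lookup-from-count a []      ()
  lookup-from-count a (x ∷ v) pos with a ≟ x
  ... | yes a≡x = zero , sym a≡x
  ... | no  _   = let j , vj≡a = lookup-from-count a v pos in suc j , vj≡a

  counts-removeAt : ∀ {n} (u : Vec A (suc n)) (v : Vec A n) {y} j → lookup u j ≡ y →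
                    (∀ a → count (a ≟_) u ≡ count (a ≟_) (y ∷ v)) →
                    ∀ a → count (a ≟_) (removeAt u j) ≡ count (a ≟_) v
  counts-removeAt u v {y} j uj≡y same a = count-∷-cancel (a ≟_) y (removeAt u j) v (begin
    count (a ≟_) (y ∷ removeAt u j)           ≡⟨ cong (λ z → count (a ≟_) (z ∷ removeAt u j)) uj≡y ⟨
    count (a ≟_) (lookup u j ∷ removeAt u j)  ≡⟨ count-removeAt (a ≟_) u j ⟩
    count (a ≟_) u                            ≡⟨ same a ⟩
    count (a ≟_) (y ∷ v)                      ∎)

  permutation-from-counts : ∀ {n} (u v : Vec A n) → (∀ a → count (a ≟_) u ≡ count (a ≟_) v) →
                            Σ (Permutation′ n) λ σ → ∀ i → lookup v i ≡ lookup u (σ ⟨$⟩ʳ i)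
  permutation-from-counts []  []      _    = Perm.id , λ ()
  permutation-from-counts u   (y ∷ v) same =
    let j , uj≡y = lookup-from-count y u (subst (0 <_) (sym (same y)) (count-here y v))
        σ , σ-ok = permutation-from-counts (removeAt u j) v (counts-removeAt u v j uj≡y same)
    in Perm.insert zero j σ , insert-lookup u v j σ uj≡y σ-ok

Span : ∀ {n k} → Vec (Word n) k → Code n
Span G x = ∃ λ c → lincomb c G ≡ x

_≐_ : ∀ {n} → Code n → Code n → Set
C ≐ D = ∀ x → C x ⇔ D x

GoodLCD-resp : ∀ {n k d} {C D : Code n} → C ≐ D → GoodLCD n k d C → GoodLCD n k d D
GoodLCD-resp {C = C} {D} C≐D (((G , indep , spans) , (x , Cx , x≢0 , wt-x) , lower) , lcd , dual≥2) =
  ((G , indep , λ y → mk⇔ (to (spans y) ∘ from (C≐D y)) (to (C≐D y) ∘ from (spans y))) ,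
   (x , to (C≐D x) Cx , x≢0 , wt-x) , λ y Dy → lower y (from (C≐D y) Dy)) ,
  (λ y Dy D⊥y → lcd y (from (C≐D y) Dy) (dual-to-dual y D⊥y)) ,
  (λ y D⊥y → dual≥2 y (dual-to-dual y D⊥y))
  where
  dual-to-dual : ∀ y → Dual D y → Dual C y
  dual-to-dual y D⊥y z Cz = D⊥y z (to (C≐D z) Cz)

Equivalent-respˡ : ∀ {n} {C C′ D : Code n} → C ≐ C′ → Equivalent C′ D → Equivalent C D
Equivalent-respˡ C≐C′ (σ , C′≈D) = σ , λ x → mk⇔ (to (C′≈D x) ∘ to (C≐C′ x)) (from (C≐C′ x) ∘ from (C′≈D x))

permute-Equivalent : ∀ {n k} (σ : Permutation′ n) (G : Vec (Word n) k) →
                     Equivalent (Span G) (Span (map (permute σ) G))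
permute-Equivalent σ G = σ , λ x → mk⇔
  (λ (c , Gc≡x) → c , trans (sym (permute-lincomb σ c G)) (cong (permute σ) Gc≡x))
  (λ (c , σGc≡σx) → c , permute-injective σ (trans (permute-lincomb σ c G) σGc≡σx))

Equivalent-preserves-weight : ∀ {n} {C D : Code n} → Equivalent C D → ∀ {x} → C x → ∃ λ y → D y × wt y ≡ wt x
Equivalent-preserves-weight (σ , C≈D) {x} Cx = permute σ x , to (C≈D x) Cx , wt-permute σ x

weight-separates : ∀ {n w} {C D : Code n} {x} → C x → (∀ {y} → D y → wt y ≤ w) → w < wt x → ¬ Equivalent C D
weight-separates {C = C} {D} Cx bound w<wt-x equivalent =
  let y , Dy , wt-y = Equivalent-preserves-weight {C = C} {D} equivalent Cx
  in <⇒≱ w<wt-x (subst (_≤ _) wt-y (bound {y} Dy))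

Span₂ : ∀ {n} → Word n → Word n → Code n
Span₂ g₁ g₂ = Span (g₁ ∷ g₂ ∷ [])

comb : ∀ {n} → Bool → Bool → Word n → Word n → Word n
comb false false g₁ g₂ = 0w
comb true  false g₁ g₂ = g₁
comb false true  g₁ g₂ = g₂
comb true  true  g₁ g₂ = g₁ ⊕ g₂

lincomb₂ : ∀ {n} c₁ c₂ (g₁ g₂ : Word n) → lincomb (c₁ ∷ c₂ ∷ []) (g₁ ∷ g₂ ∷ []) ≡ comb c₁ c₂ g₁ g₂
lincomb₂ false false g₁ g₂ = trans (⊕-identityˡ _) (⊕-identityˡ _)
lincomb₂ true  false g₁ g₂ = trans (cong (g₁ ⊕_) (⊕-identityˡ _)) (⊕-identityʳ g₁)
lincomb₂ false true  g₁ g₂ = trans (⊕-identityˡ _) (⊕-identityʳ g₂)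
lincomb₂ true  true  g₁ g₂ = cong (g₁ ⊕_) (⊕-identityʳ g₂)

comb∈Span₂ : ∀ {n} c₁ c₂ (g₁ g₂ : Word n) → Span₂ g₁ g₂ (comb c₁ c₂ g₁ g₂)
comb∈Span₂ c₁ c₂ g₁ g₂ = (c₁ ∷ c₂ ∷ []) , lincomb₂ c₁ c₂ g₁ g₂

Span₂-comb : ∀ {n} {g₁ g₂ x : Word n} → Span₂ g₁ g₂ x → ∃₂ λ c₁ c₂ → comb c₁ c₂ g₁ g₂ ≡ x
Span₂-comb {g₁ = g₁} {g₂} ((c₁ ∷ c₂ ∷ []) , eq) = c₁ , c₂ , trans (sym (lincomb₂ c₁ c₂ g₁ g₂)) eq

Span₂-ind : ∀ {n} {g₁ g₂ : Word n} (P : Word n → Set) → P 0w → P g₁ → P g₂ → P (g₁ ⊕ g₂) →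
            ∀ {x} → Span₂ g₁ g₂ x → P x
Span₂-ind P P0 P₁ P₂ P₁₂ s with Span₂-comb s
... | false , false , refl = P0
... | true  , false , refl = P₁
... | false , true  , refl = P₂
... | true  , true  , refl = P₁₂

Span₂-rotate : ∀ {n} (g₁ g₂ : Word n) → Span₂ g₁ g₂ ≐ Span₂ g₂ (g₁ ⊕ g₂)
Span₂-rotate g₁ g₂ x = mk⇔
  (Span₂-ind (Span₂ g₂ (g₁ ⊕ g₂)) (in-new false false)
     (subst (Span₂ g₂ (g₁ ⊕ g₂)) (⊕-cancelˡ g₁ g₂) (in-new true true)) (in-new true false) (in-new false true))
  (Span₂-ind (Span₂ g₁ g₂) (in-old false false) (in-old false true) (in-old true true)
     (subst (Span₂ g₁ g₂) (sym (⊕-cancelˡ g₁ g₂)) (in-old true false)))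
  where
  in-new : ∀ c₁ c₂ → Span₂ g₂ (g₁ ⊕ g₂) (comb c₁ c₂ g₂ (g₁ ⊕ g₂))
  in-old : ∀ c₁ c₂ → Span₂ g₁ g₂ (comb c₁ c₂ g₁ g₂)
  in-new c₁ c₂ = comb∈Span₂ c₁ c₂ g₂ (g₁ ⊕ g₂)
  in-old c₁ c₂ = comb∈Span₂ c₁ c₂ g₁ g₂

comb≢0w : ∀ {n} {g₁ g₂ : Word n} c₁ c₂ → LinIndep (g₁ ∷ g₂ ∷ []) → ¬ (c₁ ≡ false × c₂ ≡ false) →
          comb c₁ c₂ g₁ g₂ ≢ 0w
comb≢0w {g₁ = g₁} {g₂} c₁ c₂ indep c≢0 eq with refl ← indep (c₁ ∷ c₂ ∷ []) (trans (lincomb₂ c₁ c₂ g₁ g₂) eq) =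
  c≢0 (refl , refl)

-- Column profiles

Column : Set
Column = Bool × Bool

_≟ᶜ_ : DecidableEquality Column
_≟ᶜ_ = ≡-dec _≟ᵇ_ _≟ᵇ_

columns : ∀ {n} → Word n → Word n → Vec Column n
columns = zipWith _,_

#[_] : ∀ {n} → Column → Word n → Word n → ℕ
#[ c ] g₁ g₂ = count (c ≟ᶜ_) (columns g₁ g₂)

ℕ³ : Set
ℕ³ = ℕ × ℕ × ℕ

sum₃ : ℕ³ → ℕ
sum₃ (a , b , c) = a + (b + c)

All₃ : (ℕ → Set) → ℕ³ → Set
All₃ P (a , b , c) = P a × P b × P c

Any₃ : (ℕ → Set) → ℕ³ → Set
Any₃ P (a , b , c) = P a ⊎ P b ⊎ P c

All₃-map : ∀ {P Q : ℕ → Set} → (∀ {k} → P k → Q k) → ∀ v → All₃ P v → All₃ Q v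
All₃-map f _ (p , q , r) = f p , f q , f r

positive-weights⇒independent : ∀ {n} (g₁ g₂ : Word n) → All₃ (0 <_) (wt g₁ , wt g₂ , wt (g₁ ⊕ g₂)) →
                               LinIndep (g₁ ∷ g₂ ∷ [])
positive-weights⇒independent g₁ g₂ (pos₁ , pos₂ , pos₁₂) (c₁ ∷ c₂ ∷ []) eq =
  trivial c₁ c₂ (trans (sym (lincomb₂ c₁ c₂ g₁ g₂)) eq)
  where
  trivial : ∀ c₁ c₂ → comb c₁ c₂ g₁ g₂ ≡ 0w → c₁ ∷ c₂ ∷ [] ≡ false ∷ false ∷ []
  trivial false false _  = refl
  trivial true  false eq = ⊥-elim (0<wt⇒≢0w pos₁ eq)
  trivial false true  eq = ⊥-elim (0<wt⇒≢0w pos₂ eq)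
  trivial true  true  eq = ⊥-elim (0<wt⇒≢0w pos₁₂ eq)

profile : ∀ {n} → Word n → Word n → ℕ³
profile g₁ g₂ = #[ true , false ] g₁ g₂ , #[ false , true ] g₁ g₂ , #[ true , true ] g₁ g₂

weights : ℕ³ → ℕ³
weights (a , b , c) = a + c , b + c , a + b

rotate : ℕ³ → ℕ³
rotate (a , b , c) = c , a , b

columns-total : ∀ {n} (g₁ g₂ : Word n) → #[ false , false ] g₁ g₂ + sum₃ (profile g₁ g₂) ≡ n
columns-total [] [] = refl
columns-total (false ∷ g₁) (false ∷ g₂) = cong suc (columns-total g₁ g₂)
columns-total (true  ∷ g₁) (false ∷ g₂) = trans (+-suc _ _) (cong suc (columns-total g₁ g₂))
columns-total (false ∷ g₁) (true  ∷ g₂) =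
  trans (cong (#[ false , false ] g₁ g₂ +_) (+-suc _ _)) (trans (+-suc _ _) (cong suc (columns-total g₁ g₂)))
columns-total (true  ∷ g₁) (true  ∷ g₂) =
  trans (cong (λ k → #[ false , false ] g₁ g₂ + (#[ true , false ] g₁ g₂ + k)) (+-suc _ _))
    (trans (cong (#[ false , false ] g₁ g₂ +_) (+-suc _ _)) (trans (+-suc _ _) (cong suc (columns-total g₁ g₂))))

wt-g₁ : ∀ {n} (g₁ g₂ : Word n) → wt g₁ ≡ #[ true , false ] g₁ g₂ + #[ true , true ] g₁ g₂
wt-g₁ [] [] = refl
wt-g₁ (false ∷ g₁) (false ∷ g₂) = wt-g₁ g₁ g₂
wt-g₁ (true  ∷ g₁) (false ∷ g₂) = cong suc (wt-g₁ g₁ g₂)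
wt-g₁ (false ∷ g₁) (true  ∷ g₂) = wt-g₁ g₁ g₂
wt-g₁ (true  ∷ g₁) (true  ∷ g₂) = trans (cong suc (wt-g₁ g₁ g₂)) (sym (+-suc _ _))

wt-g₂ : ∀ {n} (g₁ g₂ : Word n) → wt g₂ ≡ #[ false , true ] g₁ g₂ + #[ true , true ] g₁ g₂
wt-g₂ [] [] = refl
wt-g₂ (false ∷ g₁) (false ∷ g₂) = wt-g₂ g₁ g₂
wt-g₂ (true  ∷ g₁) (false ∷ g₂) = wt-g₂ g₁ g₂
wt-g₂ (false ∷ g₁) (true  ∷ g₂) = cong suc (wt-g₂ g₁ g₂)
wt-g₂ (true  ∷ g₁) (true  ∷ g₂) = trans (cong suc (wt-g₂ g₁ g₂)) (sym (+-suc _ _))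

wt-g₁⊕g₂ : ∀ {n} (g₁ g₂ : Word n) → wt (g₁ ⊕ g₂) ≡ #[ true , false ] g₁ g₂ + #[ false , true ] g₁ g₂
wt-g₁⊕g₂ [] [] = refl
wt-g₁⊕g₂ (false ∷ g₁) (false ∷ g₂) = wt-g₁⊕g₂ g₁ g₂
wt-g₁⊕g₂ (true  ∷ g₁) (false ∷ g₂) = cong suc (wt-g₁⊕g₂ g₁ g₂)
wt-g₁⊕g₂ (false ∷ g₁) (true  ∷ g₂) = trans (cong suc (wt-g₁⊕g₂ g₁ g₂)) (sym (+-suc _ _))
wt-g₁⊕g₂ (true  ∷ g₁) (true  ∷ g₂) = wt-g₁⊕g₂ g₁ g₂

generator-weights : ∀ {n} (g₁ g₂ : Word n) → (wt g₁ , wt g₂ , wt (g₁ ⊕ g₂)) ≡ weights (profile g₁ g₂)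
generator-weights g₁ g₂ = cong₂ _,_ (wt-g₁ g₁ g₂) (cong₂ _,_ (wt-g₂ g₁ g₂) (wt-g₁⊕g₂ g₁ g₂))

∙≡odd-#[11] : ∀ {n} (g₁ g₂ : Word n) → g₁ ∙ g₂ ≡ odd (#[ true , true ] g₁ g₂)
∙≡odd-#[11] [] [] = refl
∙≡odd-#[11] (false ∷ g₁) (false ∷ g₂) = ∙≡odd-#[11] g₁ g₂
∙≡odd-#[11] (true  ∷ g₁) (false ∷ g₂) = ∙≡odd-#[11] g₁ g₂
∙≡odd-#[11] (false ∷ g₁) (true  ∷ g₂) = ∙≡odd-#[11] g₁ g₂
∙≡odd-#[11] (true  ∷ g₁) (true  ∷ g₂) = cong not (∙≡odd-#[11] g₁ g₂)

profile-rotate : ∀ {n} (g₁ g₂ : Word n) → profile g₂ (g₁ ⊕ g₂) ≡ rotate (profile g₁ g₂)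
profile-rotate [] [] = refl
profile-rotate (false ∷ g₁) (false ∷ g₂) = profile-rotate g₁ g₂
profile-rotate (true  ∷ g₁) (false ∷ g₂) = cong (λ (a , b , c) → a , suc b , c) (profile-rotate g₁ g₂)
profile-rotate (false ∷ g₁) (true  ∷ g₂) = cong (λ (a , b , c) → a , b , suc c) (profile-rotate g₁ g₂)
profile-rotate (true  ∷ g₁) (true  ∷ g₂) = cong (λ (a , b , c) → suc a , b , c) (profile-rotate g₁ g₂)

#[00]-rotate : ∀ {n} (g₁ g₂ : Word n) → #[ false , false ] g₂ (g₁ ⊕ g₂) ≡ #[ false , false ] g₁ g₂
#[00]-rotate [] [] = refl
#[00]-rotate (false ∷ g₁) (false ∷ g₂) = cong suc (#[00]-rotate g₁ g₂)
#[00]-rotate (true  ∷ g₁) (false ∷ g₂) = #[00]-rotate g₁ g₂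
#[00]-rotate (false ∷ g₁) (true  ∷ g₂) = #[00]-rotate g₁ g₂
#[00]-rotate (true  ∷ g₁) (true  ∷ g₂) = #[00]-rotate g₁ g₂

lookup-columns : ∀ {n} (x y : Word n) i → lookup (columns x y) i ≡ (lookup x i , lookup y i)
lookup-columns x y i = lookup-zipWith _,_ i x y

Span₂-weights : ∀ {n} (P : ℕ → Set) (g₁ g₂ : Word n) → P 0 → All₃ P (weights (profile g₁ g₂)) →
                ∀ {x} → Span₂ g₁ g₂ x → P (wt x)
Span₂-weights {n} P g₁ g₂ P0 all =
  let P₁ , P₂ , P₁₂ = subst (All₃ P) (sym (generator-weights g₁ g₂)) all
  in Span₂-ind (P ∘ wt) (subst P (sym (wt-0w n)) P0) P₁ P₂ P₁₂

weight-attained : ∀ {n w} (g₁ g₂ : Word n) → Any₃ (w ≡_) (weights (profile g₁ g₂)) →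
                  ∃ λ x → Span₂ g₁ g₂ x × wt x ≡ w
weight-attained g₁ g₂ attained with subst (Any₃ (_ ≡_)) (sym (generator-weights g₁ g₂)) attained
... | inj₁ eq        = g₁      , comb∈Span₂ true  false g₁ g₂ , sym eq
... | inj₂ (inj₁ eq) = g₂      , comb∈Span₂ false true  g₁ g₂ , sym eq
... | inj₂ (inj₂ eq) = g₁ ⊕ g₂ , comb∈Span₂ true  true  g₁ g₂ , sym eq

-- The dual distance

zero-column⇒orthogonal-unit : ∀ {n} (g₁ g₂ : Word n) → 0 < #[ false , false ] g₁ g₂ →
                              ∃ λ x → wt x ≡ 1 × x ∙ g₁ ≡ false × x ∙ g₂ ≡ false
zero-column⇒orthogonal-unit [] [] ()
zero-column⇒orthogonal-unit {suc n} (false ∷ g₁) (false ∷ g₂) _ =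
  (true ∷ 0w) , cong suc (wt-0w n) , ∙-zeroˡ g₁ , ∙-zeroˡ g₂
zero-column⇒orthogonal-unit (true  ∷ g₁) (false ∷ g₂) pos =
  Product.map (false ∷_) id (zero-column⇒orthogonal-unit g₁ g₂ pos)
zero-column⇒orthogonal-unit (false ∷ g₁) (true  ∷ g₂) pos =
  Product.map (false ∷_) id (zero-column⇒orthogonal-unit g₁ g₂ pos)
zero-column⇒orthogonal-unit (true  ∷ g₁) (true  ∷ g₂) pos =
  Product.map (false ∷_) id (zero-column⇒orthogonal-unit g₁ g₂ pos)

orthogonal-unit⇒zero-column : ∀ {n} (x g₁ g₂ : Word n) → wt x ≡ 1 → x ∙ g₁ ≡ false → x ∙ g₂ ≡ false →
                              0 < #[ false , false ] g₁ g₂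
orthogonal-unit⇒zero-column (false ∷ x) (a ∷ g₁) (b ∷ g₂) wt-x x⊥g₁ x⊥g₂ =
  <-≤-trans (orthogonal-unit⇒zero-column x g₁ g₂ wt-x x⊥g₁ x⊥g₂)
            (count-≤-∷ ((false , false) ≟ᶜ_) (a , b) (columns g₁ g₂))
orthogonal-unit⇒zero-column (true ∷ x) (a ∷ g₁) (b ∷ g₂) wt-x x⊥g₁ x⊥g₂
  with refl ← wt≡0⇒0w x (suc-injective wt-x)
  with refl ← trans (sym (unit∙ a g₁)) x⊥g₁ | refl ← trans (sym (unit∙ b g₂)) x⊥g₂ = s≤s z≤n

Dual-Span₂ : ∀ {n} (g₁ g₂ x : Word n) → Dual (Span₂ g₁ g₂) x ⇔ (x ∙ g₁ ≡ false × x ∙ g₂ ≡ false)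
Dual-Span₂ g₁ g₂ x = mk⇔
  (λ x⊥ → x⊥ g₁ (comb∈Span₂ true false g₁ g₂) , x⊥ g₂ (comb∈Span₂ false true g₁ g₂))
  (λ (x⊥g₁ , x⊥g₂) y → Span₂-ind (λ y → x ∙ y ≡ false) (∙-zeroʳ x) x⊥g₁ x⊥g₂
                          (trans (∙-distribˡ-⊕ x g₁ g₂) (cong₂ _xor_ x⊥g₁ x⊥g₂)) {y})

dual-distance⇒no-zero-column : ∀ {n} (g₁ g₂ : Word n) → MinDistAtLeast (Dual (Span₂ g₁ g₂)) 2 →
                               #[ false , false ] g₁ g₂ ≡ 0
dual-distance⇒no-zero-column g₁ g₂ dual≥2 = n≤0⇒n≡0 (≮⇒≥ λ pos →
  let x , wt-x , x⊥g₁ , x⊥g₂ = zero-column⇒orthogonal-unit g₁ g₂ pos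
  in <-irrefl (sym wt-x)
       (dual≥2 x (from (Dual-Span₂ g₁ g₂ x) (x⊥g₁ , x⊥g₂)) (0<wt⇒≢0w (≤-reflexive (sym wt-x)))))

no-zero-column⇒dual-distance : ∀ {n} (g₁ g₂ : Word n) → #[ false , false ] g₁ g₂ ≡ 0 →
                               MinDistAtLeast (Dual (Span₂ g₁ g₂)) 2
no-zero-column⇒dual-distance g₁ g₂ no-zero x x⊥ x≢0 with wt x in wt-x
... | zero        = ⊥-elim (x≢0 (wt≡0⇒0w x wt-x))
... | suc zero    = let x⊥g₁ , x⊥g₂ = to (Dual-Span₂ g₁ g₂ x) x⊥ in
                    ⊥-elim (<-irrefl (sym no-zero) (orthogonal-unit⇒zero-column x g₁ g₂ wt-x x⊥g₁ x⊥g₂))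
... | suc (suc _) = s≤s (s≤s z≤n)

-- The LCD property

Kernel : Bool → Bool → Bool → Bool → Bool → Set
Kernel α β γ c₁ c₂ = (c₁ ∧ α) xor (c₂ ∧ β) ≡ false × (c₁ ∧ β) xor (c₂ ∧ γ) ≡ false

kernel-trivial : ∀ α β γ c₁ c₂ → (α ∧ γ) xor β ≡ true → Kernel α β γ c₁ c₂ → c₁ ≡ false × c₂ ≡ false
kernel-trivial α     β     γ     false false _  _        = refl , refl
kernel-trivial true  β     γ     true  false _  (() , _)
kernel-trivial false true  γ     true  false _  (_ , ())
kernel-trivial false false γ     true  false () _
kernel-trivial α     true  γ     false true  _  (() , _)
kernel-trivial α     false true  false true  _  (_ , ())
kernel-trivial true  false false false true  () _
kernel-trivial false false false false true  () _
kernel-trivial true  true  true  true  true  () _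
kernel-trivial false false false true  true  () _
kernel-trivial true  false γ     true  true  _  (() , _)
kernel-trivial false true  γ     true  true  _  (() , _)
kernel-trivial true  true  false true  true  _  (_ , ())
kernel-trivial false false true  true  true  _  (_ , ())

kernel-nontrivial : ∀ α β γ → (α ∧ γ) xor β ≡ false →
                    ∃₂ λ c₁ c₂ → ¬ (c₁ ≡ false × c₂ ≡ false) × Kernel α β γ c₁ c₂
kernel-nontrivial true  true  true  _  = true  , true  , (λ ()) , refl , refl
kernel-nontrivial true  false false _  = false , true  , (λ ()) , refl , refl
kernel-nontrivial false false γ     _  = true  , false , (λ ()) , refl , refl
kernel-nontrivial true  true  false ()
kernel-nontrivial true  false true  ()
kernel-nontrivial false true  γ     ()

∙-comb : ∀ {n} (g : Word n) c₁ c₂ (g₁ g₂ : Word n) → g ∙ comb c₁ c₂ g₁ g₂ ≡ (c₁ ∧ g ∙ g₁) xor (c₂ ∧ g ∙ g₂)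
∙-comb g false false g₁ g₂ = ∙-zeroʳ g
∙-comb g true  false g₁ g₂ = sym (xor-identityʳ (g ∙ g₁))
∙-comb g false true  g₁ g₂ = refl
∙-comb g true  true  g₁ g₂ = ∙-distribˡ-⊕ g g₁ g₂

comb-orthogonal⇔Kernel : ∀ {n} c₁ c₂ (g₁ g₂ : Word n) →
  (comb c₁ c₂ g₁ g₂ ∙ g₁ ≡ false × comb c₁ c₂ g₁ g₂ ∙ g₂ ≡ false) ⇔ Kernel (g₁ ∙ g₁) (g₁ ∙ g₂) (g₂ ∙ g₂) c₁ c₂
comb-orthogonal⇔Kernel {n} c₁ c₂ g₁ g₂ =
  mk⇔ (Product.map (trans (sym eq₁)) (trans (sym eq₂))) (Product.map (trans eq₁) (trans eq₂))
  where
  x : Word n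
  x = comb c₁ c₂ g₁ g₂
  eq₁ : x ∙ g₁ ≡ (c₁ ∧ g₁ ∙ g₁) xor (c₂ ∧ g₁ ∙ g₂)
  eq₁ = trans (∙-comm x g₁) (∙-comb g₁ c₁ c₂ g₁ g₂)
  eq₂ : x ∙ g₂ ≡ (c₁ ∧ g₁ ∙ g₂) xor (c₂ ∧ g₂ ∙ g₂)
  eq₂ = trans (∙-comm x g₂)
          (trans (∙-comb g₂ c₁ c₂ g₁ g₂) (cong (λ β → (c₁ ∧ β) xor (c₂ ∧ g₂ ∙ g₂)) (∙-comm g₂ g₁)))

-- Over 𝔽₂ the term β² of the determinant is just β.
gramDet : ∀ {n} → Word n → Word n → Bool
gramDet g₁ g₂ = ((g₁ ∙ g₁) ∧ (g₂ ∙ g₂)) xor (g₁ ∙ g₂)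

gramDet⇒LCD : ∀ {n} (g₁ g₂ : Word n) → gramDet g₁ g₂ ≡ true → IsLCD (Span₂ g₁ g₂)
gramDet⇒LCD g₁ g₂ det x s x⊥ with Span₂-comb s
... | c₁ , c₂ , refl
    with refl , refl ← kernel-trivial (g₁ ∙ g₁) (g₁ ∙ g₂) (g₂ ∙ g₂) c₁ c₂ det
                         (to (comb-orthogonal⇔Kernel c₁ c₂ g₁ g₂)
                             (to (Dual-Span₂ g₁ g₂ (comb c₁ c₂ g₁ g₂)) x⊥)) = refl

LCD⇒gramDet : ∀ {n} (g₁ g₂ : Word n) → LinIndep (g₁ ∷ g₂ ∷ []) → IsLCD (Span₂ g₁ g₂) → gramDet g₁ g₂ ≡ true
LCD⇒gramDet g₁ g₂ indep lcd with gramDet g₁ g₂ in det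
... | true  = refl
... | false =
  let c₁ , c₂ , c≢0 , ker = kernel-nontrivial (g₁ ∙ g₁) (g₁ ∙ g₂) (g₂ ∙ g₂) det
      x = comb c₁ c₂ g₁ g₂
      x∈C⊥ = from (Dual-Span₂ g₁ g₂ x) (from (comb-orthogonal⇔Kernel c₁ c₂ g₁ g₂) ker)
  in ⊥-elim (comb≢0w c₁ c₂ indep c≢0 (lcd x (comb∈Span₂ c₁ c₂ g₁ g₂) x∈C⊥))

majority : Bool → Bool → Bool → Bool
majority true  true  _ = true
majority false false _ = false
majority _     _     r = r

gramDet≡majority : ∀ {n} (g₁ g₂ : Word n) →
                   let a , b , c = profile g₁ g₂ in gramDet g₁ g₂ ≡ majority (odd a) (odd b) (odd c)
gramDet≡majority g₁ g₂ = begin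
  ((g₁ ∙ g₁) ∧ (g₂ ∙ g₂)) xor (g₁ ∙ g₂)             ≡⟨ cong₂ (λ α γ → (α ∧ γ) xor (g₁ ∙ g₂)) α≡ γ≡ ⟩
  ((odd a xor odd c) ∧ (odd b xor odd c)) xor (g₁ ∙ g₂)
    ≡⟨ cong (((odd a xor odd c) ∧ (odd b xor odd c)) xor_) (∙≡odd-#[11] g₁ g₂) ⟩
  ((odd a xor odd c) ∧ (odd b xor odd c)) xor odd c  ≡⟨ majority-as-det (odd a) (odd b) (odd c) ⟩
  majority (odd a) (odd b) (odd c)                   ∎
  where
  a = #[ true , false ] g₁ g₂
  b = #[ false , true ] g₁ g₂
  c = #[ true , true ] g₁ g₂
  α≡ : g₁ ∙ g₁ ≡ odd a xor odd c
  α≡ = trans (∙-self g₁) (trans (cong odd (wt-g₁ g₁ g₂)) (odd-+ a c))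
  γ≡ : g₂ ∙ g₂ ≡ odd b xor odd c
  γ≡ = trans (∙-self g₂) (trans (cong odd (wt-g₂ g₁ g₂)) (odd-+ b c))
  majority-as-det : ∀ p q r → ((p xor r) ∧ (q xor r)) xor r ≡ majority p q r
  majority-as-det true  true  true  = refl
  majority-as-det true  true  false = refl
  majority-as-det true  false true  = refl
  majority-as-det true  false false = refl
  majority-as-det false true  true  = refl
  majority-as-det false true  false = refl
  majority-as-det false false true  = refl
  majority-as-det false false false = refl

Admissible : ℕ → ℕ³ → Set
Admissible d (a , b , c) = All₃ (d ≤_) (weights (a , b , c)) × majority (odd a) (odd b) (odd c) ≡ true

good-Span₂⇒admissible : ∀ {n d} (g₁ g₂ : Word n) → LinIndep (g₁ ∷ g₂ ∷ []) → GoodLCD n 2 d (Span₂ g₁ g₂) →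
                        #[ false , false ] g₁ g₂ ≡ 0 × Admissible d (profile g₁ g₂)
good-Span₂⇒admissible {d = d} g₁ g₂ indep ((_ , _ , lower) , lcd , dual≥2) =
  dual-distance⇒no-zero-column g₁ g₂ dual≥2 ,
  subst (All₃ (d ≤_)) (generator-weights g₁ g₂)
    (bound true false (λ { (() , _) }) , bound false true (λ { (_ , ()) }) , bound true true (λ { (() , _) })) ,
  trans (sym (gramDet≡majority g₁ g₂)) (LCD⇒gramDet g₁ g₂ indep lcd)
  where
  bound : ∀ c₁ c₂ → ¬ (c₁ ≡ false × c₂ ≡ false) → d ≤ wt (comb c₁ c₂ g₁ g₂)
  bound c₁ c₂ c≢0 = lower _ (comb∈Span₂ c₁ c₂ g₁ g₂) (comb≢0w c₁ c₂ indep c≢0)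

admissible⇒good-Span₂ : ∀ {n d} (g₁ g₂ : Word n) → 1 ≤ d → #[ false , false ] g₁ g₂ ≡ 0 →
                        Admissible d (profile g₁ g₂) → Any₃ (d ≡_) (weights (profile g₁ g₂)) →
                        GoodLCD n 2 d (Span₂ g₁ g₂)
admissible⇒good-Span₂ {d = d} g₁ g₂ 1≤d no-zero (bounds , maj) attained =
  let x , x∈C , wt-x = weight-attained g₁ g₂ attained
      x≢0 = 0<wt⇒≢0w (≤-trans 1≤d (≤-reflexive (sym wt-x)))
  in ((g₁ ∷ g₂ ∷ [] , indep , λ _ → mk⇔ id id) , (x , x∈C , x≢0 , wt-x) , lower) ,
     gramDet⇒LCD g₁ g₂ (trans (gramDet≡majority g₁ g₂) maj) ,
     no-zero-column⇒dual-distance g₁ g₂ no-zero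
  where
  indep : LinIndep (g₁ ∷ g₂ ∷ [])
  indep = positive-weights⇒independent g₁ g₂
    (All₃-map {P = d ≤_} (≤-trans 1≤d) (wt g₁ , wt g₂ , wt (g₁ ⊕ g₂))
       (subst (All₃ (d ≤_)) (sym (generator-weights g₁ g₂)) bounds))
  lower : ∀ x → Span₂ g₁ g₂ x → x ≢ 0w → d ≤ wt x
  lower x x∈C x≢0 =
    Span₂-weights (λ w → 0 < w → d ≤ w) g₁ g₂ (λ ())
      (All₃-map {P = d ≤_} {Q = λ w → 0 < w → d ≤ w} (λ d≤w _ → d≤w) (weights (profile g₁ g₂)) bounds)
      x∈C (≢0w⇒0<wt x≢0)

permuted-rows : ∀ {n} (g₁ g₂ h₁ h₂ : Word n) (σ : Permutation′ n) →
                (∀ i → lookup (columns h₁ h₂) i ≡ lookup (columns g₁ g₂) (σ ⟨$⟩ʳ i)) →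
                permute σ g₁ ≡ h₁ × permute σ g₂ ≡ h₂
permuted-rows g₁ g₂ h₁ h₂ σ σ-columns =
  lookup-extensionality (λ i → trans (lookup-permute σ g₁ i) (sym (,-injectiveˡ (column i)))) ,
  lookup-extensionality (λ i → trans (lookup-permute σ g₂ i) (sym (,-injectiveʳ (column i))))
  where
  column : ∀ i → (lookup h₁ i , lookup h₂ i) ≡ (lookup g₁ (σ ⟨$⟩ʳ i) , lookup g₂ (σ ⟨$⟩ʳ i))
  column i = trans (sym (lookup-columns h₁ h₂ i)) (trans (σ-columns i) (lookup-columns g₁ g₂ (σ ⟨$⟩ʳ i)))

same-columns⇒Equivalent : ∀ {n} (g₁ g₂ h₁ h₂ : Word n) →
  #[ false , false ] g₁ g₂ ≡ #[ false , false ] h₁ h₂ → profile g₁ g₂ ≡ profile h₁ h₂ →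
  Equivalent (Span₂ g₁ g₂) (Span₂ h₁ h₂)
same-columns⇒Equivalent g₁ g₂ h₁ h₂ same-00 same-profile =
  let σ , σ-columns = permutation-from-counts _≟ᶜ_ (columns g₁ g₂) (columns h₁ h₂) same-counts
      row₁ , row₂ = permuted-rows g₁ g₂ h₁ h₂ σ σ-columns
  in subst₂ (λ x y → Equivalent (Span₂ g₁ g₂) (Span₂ x y)) row₁ row₂ (permute-Equivalent σ (g₁ ∷ g₂ ∷ []))
  where
  same-counts : ∀ c → #[ c ] g₁ g₂ ≡ #[ c ] h₁ h₂
  same-counts (false , false) = same-00
  same-counts (true  , false) = cong proj₁ same-profile
  same-counts (false , true)  = cong (proj₁ ∘ proj₂) same-profile
  same-counts (true  , true)  = cong (proj₂ ∘ proj₂) same-profile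

-- Cyclic rotations suffice: every profile to be matched has two equal entries.
RotationOf : ℕ³ → ℕ³ → Set
RotationOf u v = u ≡ v ⊎ u ≡ rotate v ⊎ u ≡ rotate (rotate v)

rotate-Equivalent : ∀ {n} (g₁ g₂ h₁ h₂ : Word n) →
  #[ false , false ] g₁ g₂ ≡ #[ false , false ] h₁ h₂ → rotate (profile g₁ g₂) ≡ profile h₁ h₂ →
  Equivalent (Span₂ g₁ g₂) (Span₂ h₁ h₂)
rotate-Equivalent g₁ g₂ h₁ h₂ same-00 same-profile =
  Equivalent-respˡ {C′ = Span₂ g₂ (g₁ ⊕ g₂)} {D = Span₂ h₁ h₂} (Span₂-rotate g₁ g₂)
  (same-columns⇒Equivalent g₂ (g₁ ⊕ g₂) h₁ h₂ (trans (#[00]-rotate g₁ g₂) same-00)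
     (trans (profile-rotate g₁ g₂) same-profile))

rotation⇒Equivalent : ∀ {n} (g₁ g₂ h₁ h₂ : Word n) →
  #[ false , false ] g₁ g₂ ≡ #[ false , false ] h₁ h₂ → RotationOf (profile g₁ g₂) (profile h₁ h₂) →
  Equivalent (Span₂ g₁ g₂) (Span₂ h₁ h₂)
rotation⇒Equivalent g₁ g₂ h₁ h₂ same-00 (inj₁ eq)        = same-columns⇒Equivalent g₁ g₂ h₁ h₂ same-00 eq
rotation⇒Equivalent g₁ g₂ h₁ h₂ same-00 (inj₂ (inj₂ eq)) = rotate-Equivalent g₁ g₂ h₁ h₂ same-00 (cong rotate eq)
rotation⇒Equivalent g₁ g₂ h₁ h₂ same-00 (inj₂ (inj₁ eq)) =
  Equivalent-respˡ {C′ = Span₂ g₂ (g₁ ⊕ g₂)} {D = Span₂ h₁ h₂} (Span₂-rotate g₁ g₂)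
  (rotate-Equivalent g₂ (g₁ ⊕ g₂) h₁ h₂ (trans (#[00]-rotate g₁ g₂) same-00)
     (cong rotate (trans (profile-rotate g₁ g₂) (cong rotate eq))))

generators-with-profile : ∀ {n} (v : ℕ³) → sum₃ v ≡ n →
  Σ (Word n × Word n) λ (g₁ , g₂) → #[ false , false ] g₁ g₂ ≡ 0 × profile g₁ g₂ ≡ v
generators-with-profile {zero}  (zero  , zero  , zero)  _  = ([] , []) , refl , refl
generators-with-profile {suc n} (suc a , b     , c)     eq =
  let (g₁ , g₂) , no-zero , p = generators-with-profile (a , b , c) (suc-injective eq)
  in (true ∷ g₁ , false ∷ g₂) , no-zero , cong (λ (a , b , c) → suc a , b , c) p
generators-with-profile {suc n} (zero  , suc b , c)     eq =
  let (g₁ , g₂) , no-zero , p = generators-with-profile (zero , b , c) (suc-injective eq)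
  in (false ∷ g₁ , true ∷ g₂) , no-zero , cong (λ (a , b , c) → a , suc b , c) p
generators-with-profile {suc n} (zero  , zero  , suc c) eq =
  let (g₁ , g₂) , no-zero , p = generators-with-profile (zero , zero , c) (suc-injective eq)
  in (true ∷ g₁ , true ∷ g₂) , no-zero , cong (λ (a , b , c) → a , b , suc c) p
generators-with-profile {zero}  (suc _ , _     , _)     ()
generators-with-profile {zero}  (zero  , suc _ , _)     ()
generators-with-profile {zero}  (zero  , zero  , suc _) ()
generators-with-profile {suc _} (zero  , zero  , zero)  ()

ProfileCode : ∀ {n} (v : ℕ³) → sum₃ v ≡ n → Code n
ProfileCode v eq = let (g₁ , g₂) , _ = generators-with-profile v eq in Span₂ g₁ g₂

ProfileCode-good : ∀ {n d} v (eq : sum₃ v ≡ n) → 1 ≤ d → Admissible d v → Any₃ (d ≡_) (weights v) →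
                   GoodLCD n 2 d (ProfileCode v eq)
ProfileCode-good {d = d} v eq 1≤d admissible attained =
  let (g₁ , g₂) , no-zero , p = generators-with-profile v eq
  in admissible⇒good-Span₂ g₁ g₂ 1≤d no-zero (subst (Admissible d) (sym p) admissible)
       (subst (Any₃ (d ≡_) ∘ weights) (sym p) attained)

ProfileCode-weights : ∀ {n} (P : ℕ → Set) v (eq : sum₃ v ≡ n) → P 0 → All₃ P (weights v) →
                      ∀ {x} → ProfileCode v eq x → P (wt x)
ProfileCode-weights P v eq P0 all =
  let (g₁ , g₂) , _ , p = generators-with-profile v eq
  in Span₂-weights P g₁ g₂ P0 (subst (All₃ P ∘ weights) (sym p) all)

ProfileCode-weight-attained : ∀ {n w} v (eq : sum₃ v ≡ n) → Any₃ (w ≡_) (weights v) →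
                              ∃ λ x → ProfileCode v eq x × wt x ≡ w
ProfileCode-weight-attained {w = w} v eq attained =
  let (g₁ , g₂) , _ , p = generators-with-profile v eq
  in weight-attained g₁ g₂ (subst (Any₃ (w ≡_) ∘ weights) (sym p) attained)

good⇒profile : ∀ {n d} (D : Code n) → GoodLCD n 2 d D →
  Σ ℕ³ λ v → sum₃ v ≡ n × Admissible d v ×
    (∀ u (eq : sum₃ u ≡ n) → RotationOf v u → Equivalent D (ProfileCode u eq))
good⇒profile D good@((((g₁ ∷ g₂ ∷ []) , indep , D≐C) , _) , _) =
  let no-zero , admissible = good-Span₂⇒admissible g₁ g₂ indep (GoodLCD-resp D≐C good)
  in profile g₁ g₂ ,
     trans (cong (_+ sum₃ (profile g₁ g₂)) (sym no-zero)) (columns-total g₁ g₂) ,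
     admissible ,
     λ u eq rotation →
       let (h₁ , h₂) , no-zero′ , p = generators-with-profile u eq
       in Equivalent-respˡ {C′ = Span₂ g₁ g₂} {D = Span₂ h₁ h₂} D≐C
            (rotation⇒Equivalent g₁ g₂ h₁ h₂ (trans no-zero (sym no-zero′))
               (subst (RotationOf (profile g₁ g₂)) (sym p) rotation))

-- Shifted profiles

shift : ℕ → ℕ³ → ℕ³
shift m (x , y , z) = m + x , m + y , m + z

+-shift₂ : ∀ m x y → (m + x) + (m + y) ≡ 2 * m + (x + y)
+-shift₂ = solve-∀

+-shift₃ : ∀ m x y z → (m + x) + ((m + y) + (m + z)) ≡ 3 * m + (x + (y + z))
+-shift₃ = solve-∀

sum₃-shift : ∀ m w → sum₃ (shift m w) ≡ 3 * m + sum₃ w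
sum₃-shift m (x , y , z) = +-shift₃ m x y z

weights-shift : ∀ m w → weights (shift m w) ≡ shift (2 * m) (weights w)
weights-shift m (x , y , z) = cong₂ _,_ (+-shift₂ m x z) (cong₂ _,_ (+-shift₂ m y z) (+-shift₂ m x y))

All₃-shift : ∀ k L w → All₃ (k + L ≤_) (shift k w) ⇔ All₃ (L ≤_) w
All₃-shift k L (x , y , z) = mk⇔
  (λ (p , q , r) → +-cancelˡ-≤ k L x p , +-cancelˡ-≤ k L y q , +-cancelˡ-≤ k L z r)
  (λ (p , q , r) → +-monoʳ-≤ k p , +-monoʳ-≤ k q , +-monoʳ-≤ k r)

Any₃-shift : ∀ k {L} v → Any₃ (L ≡_) v → Any₃ (k + L ≡_) (shift k v)
Any₃-shift k _ (inj₁ eq)        = inj₁ (cong (k +_) eq)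
Any₃-shift k _ (inj₂ (inj₁ eq)) = inj₂ (inj₁ (cong (k +_) eq))
Any₃-shift k _ (inj₂ (inj₂ eq)) = inj₂ (inj₂ (cong (k +_) eq))

RotationOf-shift : ∀ m {v w u} → v ≡ shift m w → RotationOf w u → RotationOf v (shift m u)
RotationOf-shift m refl (inj₁ refl)        = inj₁ refl
RotationOf-shift m refl (inj₂ (inj₁ refl)) = inj₂ (inj₁ refl)
RotationOf-shift m refl (inj₂ (inj₂ refl)) = inj₂ (inj₂ refl)

odd-double : ∀ s → odd (s + s) ≡ false
odd-double zero    = refl
odd-double (suc s) rewrite +-suc s s = trans (not-involutive (odd (s + s))) (odd-double s)

odd-double+ : ∀ s x → odd ((s + s) + x) ≡ odd x
odd-double+ s x = trans (odd-+ (s + s) x) (cong (_xor odd x) (odd-double s))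

-- The shift has to be even to preserve parities.
Admissible-shift : ∀ s L w → Admissible (2 * (s + s) + L) (shift (s + s) w) ⇔ Admissible L w
Admissible-shift s L (x , y , z) =
  mk⇔ (Product.map (to bounds) (trans (sym parity))) (Product.map (from bounds) (trans parity))
  where
  m : ℕ
  m = s + s
  bounds : All₃ (2 * m + L ≤_) (weights (shift m (x , y , z))) ⇔ All₃ (L ≤_) (weights (x , y , z))
  bounds = subst (λ u → All₃ (2 * m + L ≤_) u ⇔ All₃ (L ≤_) (weights (x , y , z)))
             (sym (weights-shift m (x , y , z))) (All₃-shift (2 * m) L (weights (x , y , z)))
  parity : majority (odd (m + x)) (odd (m + y)) (odd (m + z)) ≡ majority (odd x) (odd y) (odd z)
  parity rewrite odd-double+ s x | odd-double+ s y | odd-double+ s z = refl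

shifted-ProfileCode-good : ∀ {n d} s L u (eq : sum₃ (shift (s + s) u) ≡ n) → d ≡ 2 * (s + s) + L → 1 ≤ L →
                           Admissible L u → Any₃ (L ≡_) (weights u) →
                           GoodLCD n 2 d (ProfileCode (shift (s + s) u) eq)
shifted-ProfileCode-good s L u eq refl 1≤L admissible attained =
  ProfileCode-good (shift m u) eq (≤-trans 1≤L (m≤n+m L (2 * m))) (from (Admissible-shift s L u) admissible)
    (subst (Any₃ (2 * m + L ≡_)) (sym (weights-shift m u)) (Any₃-shift (2 * m) (weights u) attained))
  where
  m : ℕ
  m = s + s

m+n≡o+p∧p≤n⇒m≤o : ∀ {m n o p} → m + n ≡ o + p → p ≤ n → m ≤ o
m+n≡o+p∧p≤n⇒m≤o {m} {n} {o} {p} eq p≤n = +-cancelʳ-≤ p m o (≤-trans (+-monoʳ-≤ m p≤n) (≤-reflexive eq))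

window : ∀ m K L (v : ℕ³) → K ≤ L → sum₃ v ≡ 3 * m + (K + L) → All₃ (2 * m + L ≤_) (weights v) →
         Σ ℕ³ λ w → v ≡ shift m w × All₃ (_≤ K) w
window m K L (a , b , c) K≤L total (a+c≥ , b+c≥ , a+b≥) =
  let total-b = trans (b-first a b c) total
      total-c = trans (c-first a b c) total
      a≤ = upper total b+c≥
      b≤ = upper total-b a+c≥
      c≤ = upper total-c a+b≥
      x , a≡ , x≤K = offset (lower total b≤ c≤) a≤
      y , b≡ , y≤K = offset (lower total-b a≤ c≤) b≤
      z , c≡ , z≤K = offset (lower total-c a≤ b≤) c≤
  in (x , y , z) , cong₂ _,_ a≡ (cong₂ _,_ b≡ c≡) , x≤K , y≤K , z≤K
  where
  b-first : ∀ a b c → b + (a + c) ≡ a + (b + c)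
  b-first = solve-∀
  c-first : ∀ a b c → c + (a + b) ≡ a + (b + c)
  c-first = solve-∀
  split-upper : ∀ m K L → 3 * m + (K + L) ≡ (m + K) + (2 * m + L)
  split-upper = solve-∀
  split-lower : ∀ m K L → 3 * m + (K + L) ≡ m + (2 * m + (K + L))
  split-lower = solve-∀
  upper : ∀ {x r} → x + r ≡ 3 * m + (K + L) → 2 * m + L ≤ r → x ≤ m + K
  upper eq r≥ = m+n≡o+p∧p≤n⇒m≤o (trans eq (split-upper m K L)) r≥
  lower : ∀ {x y z} → x + (y + z) ≡ 3 * m + (K + L) → y ≤ m + K → z ≤ m + K → m ≤ x
  lower eq y≤ z≤ = m+n≡o+p∧p≤n⇒m≤o (sym (trans eq (split-lower m K L)))
    (≤-trans (+-mono-≤ y≤ z≤) (≤-trans (≤-reflexive (+-shift₂ m K K)) (+-monoʳ-≤ (2 * m) (+-monoʳ-≤ K K≤L))))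
  offset : ∀ {x} → m ≤ x → x ≤ m + K → ∃ λ k → x ≡ m + k × k ≤ K
  offset m≤x x≤ = let k , m+k≡x = m≤n⇒∃[o]m+o≡n m≤x in
    k , sym m+k≡x , +-cancelˡ-≤ m k K (subst (_≤ m + K) (sym m+k≡x) x≤)

_≟³_ : DecidableEquality ℕ³
_≟³_ = ≡-dec _≟_ (≡-dec _≟_ _≟_)

admissible? : ∀ d v → Dec (Admissible d v)
admissible? d (a , b , c) =
  ((d ≤? a + c) ×-dec (d ≤? b + c) ×-dec (d ≤? a + b)) ×-dec (majority (odd a) (odd b) (odd c) ≟ᵇ true)

rotationOf? : ∀ u v → Dec (RotationOf u v)
rotationOf? u v = (u ≟³ v) ⊎-dec (u ≟³ rotate v) ⊎-dec (u ≟³ rotate (rotate v))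

all₃UpTo? : ∀ {T : ℕ³ → Set} → U.Decidable T → ∀ k →
            Dec (∀ {x} → x < k → ∀ {y} → y < k → ∀ {z} → z < k → T (x , y , z))
all₃UpTo? T? k = allUpTo? (λ x → allUpTo? (λ y → allUpTo? (λ z → T? (x , y , z)) k) k) k

by-exhaustion : ∀ {T : ℕ³ → Set} (T? : U.Decidable T) K → True (all₃UpTo? T? (suc K)) →
                ∀ w → All₃ (_≤ K) w → T w
by-exhaustion T? K ok (x , y , z) (x≤K , y≤K , z≤K) = toWitness ok (s≤s x≤K) (s≤s y≤K) (s≤s z≤K)

classify : ∀ {n d} s K L {T : ℕ³ → Set} → K ≤ L → n ≡ 3 * (s + s) + (K + L) → d ≡ 2 * (s + s) + L →
           (∀ w → All₃ (_≤ K) w → sum₃ w ≡ K + L → Admissible L w → T w) →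
           ∀ v → sum₃ v ≡ n → Admissible d v → ∃ λ w → v ≡ shift (s + s) w × T w
classify s K L K≤L refl refl check v total admissible =
  let w , v≡ , bounded = window (s + s) K L v K≤L total (proj₁ admissible)
      admissible′ = to (Admissible-shift s L w) (subst (Admissible _) v≡ admissible)
      total′ = +-cancelˡ-≡ (3 * (s + s)) _ _
                 (trans (sym (sum₃-shift (s + s) w)) (trans (cong sum₃ (sym v≡)) total))
  in w , v≡ , check w bounded total′ admissible′

LCD-[6t+4,2,4t+2]-unique : (t : ℕ) →
  Σ (Code (6 * t + 4)) λ C →
    GoodLCD (6 * t + 4) 2 (4 * t + 2) C ×
    ((D : Code (6 * t + 4)) → GoodLCD (6 * t + 4) 2 (4 * t + 2) D → Equivalent D C)
LCD-[6t+4,2,4t+2]-unique t =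
  C , shifted-ProfileCode-good t 2 u sum-u d≡ (s≤s z≤n) (from-yes (admissible? 2 u)) (inj₂ (inj₁ refl)) , unique
  where
  m : ℕ
  m = t + t
  u : ℕ³
  u = 2 , 1 , 1
  n≡ : 6 * t + 4 ≡ 3 * m + (2 + 2)
  n≡ = arith t
    where arith : ∀ t → 6 * t + 4 ≡ 3 * (t + t) + (2 + 2)
          arith = solve-∀
  d≡ : 4 * t + 2 ≡ 2 * m + 2
  d≡ = arith t
    where arith : ∀ t → 4 * t + 2 ≡ 2 * (t + t) + 2
          arith = solve-∀
  sum-u : sum₃ (shift m u) ≡ 6 * t + 4
  sum-u = trans (sum₃-shift m u) (sym n≡)
  C : Code (6 * t + 4)
  C = ProfileCode (shift m u) sum-u
  check : ∀ w → All₃ (_≤ 2) w → sum₃ w ≡ 2 + 2 → Admissible 2 w → RotationOf w u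
  check = by-exhaustion (λ w → (sum₃ w ≟ 4) →-dec (admissible? 2 w →-dec rotationOf? w u)) 2 _
  unique : (D : Code (6 * t + 4)) → GoodLCD (6 * t + 4) 2 (4 * t + 2) D → Equivalent D C
  unique D good =
    let v , total , admissible , equivalent = good⇒profile D good
        w , v≡ , rotation = classify t 2 2 ≤-refl n≡ d≡ check v total admissible
    in equivalent (shift m u) sum-u (RotationOf-shift m v≡ rotation)

LCD-[6t+5,2,4t+2]-two-classes : (t : ℕ) → 1 ≤ t →
  Σ (Code (6 * t + 5)) λ C₁ → Σ (Code (6 * t + 5)) λ C₂ →
    GoodLCD (6 * t + 5) 2 (4 * t + 2) C₁ ×
    GoodLCD (6 * t + 5) 2 (4 * t + 2) C₂ ×
    ¬ Equivalent C₁ C₂ ×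
    ((D : Code (6 * t + 5)) → GoodLCD (6 * t + 5) 2 (4 * t + 2) D →
      Equivalent D C₁ ⊎ Equivalent D C₂)
LCD-[6t+5,2,4t+2]-two-classes (suc s) (s≤s z≤n) =
  C₁ , C₂ ,
  shifted-ProfileCode-good s 6 u₁ sum-u₁ d≡ (s≤s z≤n) (from-yes (admissible? 6 u₁)) (inj₁ refl) ,
  shifted-ProfileCode-good s 6 u₂ sum-u₂ d≡ (s≤s z≤n) (from-yes (admissible? 6 u₂)) (inj₂ (inj₁ refl)) ,
  inequivalent , classes
  where
  m : ℕ
  m = s + s
  u₁ u₂ : ℕ³
  u₁ = 1 , 5 , 5
  u₂ = 5 , 3 , 3
  n≡ : 6 * suc s + 5 ≡ 3 * m + (5 + 6)
  n≡ = arith s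
    where arith : ∀ s → 6 * suc s + 5 ≡ 3 * (s + s) + (5 + 6)
          arith = solve-∀
  d≡ : 4 * suc s + 2 ≡ 2 * m + 6
  d≡ = arith s
    where arith : ∀ s → 4 * suc s + 2 ≡ 2 * (s + s) + 6
          arith = solve-∀
  sum-u₁ : sum₃ (shift m u₁) ≡ 6 * suc s + 5
  sum-u₁ = trans (sum₃-shift m u₁) (sym n≡)
  sum-u₂ : sum₃ (shift m u₂) ≡ 6 * suc s + 5
  sum-u₂ = trans (sum₃-shift m u₂) (sym n≡)
  C₁ C₂ : Code (6 * suc s + 5)
  C₁ = ProfileCode (shift m u₁) sum-u₁
  C₂ = ProfileCode (shift m u₂) sum-u₂
  -- weights (1 , 5 , 5) = (6 , 10 , 6) and weights (5 , 3 , 3) = (8 , 6 , 8)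
  heavy : ∃ λ x → C₁ x × wt x ≡ 2 * m + 10
  heavy = ProfileCode-weight-attained (shift m u₁) sum-u₁
            (subst (Any₃ (2 * m + 10 ≡_)) (sym (weights-shift m u₁)) (inj₂ (inj₁ refl)))
  light : ∀ {y} → C₂ y → wt y ≤ 2 * m + 8
  light = ProfileCode-weights (_≤ 2 * m + 8) (shift m u₂) sum-u₂ z≤n
            (subst (All₃ (_≤ 2 * m + 8)) (sym (weights-shift m u₂))
               (≤-refl , +-monoʳ-≤ (2 * m) (m≤m+n 6 2) , ≤-refl))
  inequivalent : ¬ Equivalent C₁ C₂
  inequivalent = let x , x∈C₁ , wt-x = heavy in
    weight-separates {C = C₁} {C₂} x∈C₁ light (subst (2 * m + 8 <_) (sym wt-x) (+-monoʳ-< (2 * m) (m≤m+n 9 1)))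
  check : ∀ w → All₃ (_≤ 5) w → sum₃ w ≡ 5 + 6 → Admissible 6 w → RotationOf w u₁ ⊎ RotationOf w u₂
  check = by-exhaustion
    (λ w → (sum₃ w ≟ 11) →-dec (admissible? 6 w →-dec (rotationOf? w u₁ ⊎-dec rotationOf? w u₂))) 5 _
  classes : (D : Code (6 * suc s + 5)) → GoodLCD (6 * suc s + 5) 2 (4 * suc s + 2) D →
            Equivalent D C₁ ⊎ Equivalent D C₂
  classes D good =
    let v , total , admissible , equivalent = good⇒profile D good
        w , v≡ , rotation = classify s 5 6 (n≤1+n 5) n≡ d≡ check v total admissible
    in Sum.map (equivalent (shift m u₁) sum-u₁ ∘ RotationOf-shift m v≡)
               (equivalent (shift m u₂) sum-u₂ ∘ RotationOf-shift m v≡) rotation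

lemma4p6 :
    ((t : ℕ) →
      Σ (Code (6 * t + 4)) λ C →
        GoodLCD (6 * t + 4) 2 (4 * t + 2) C ×
        ((D : Code (6 * t + 4)) → GoodLCD (6 * t + 4) 2 (4 * t + 2) D → Equivalent D C))
    ×
    ((t : ℕ) → 1 ≤ t →
      Σ (Code (6 * t + 5)) λ C₁ → Σ (Code (6 * t + 5)) λ C₂ →
        GoodLCD (6 * t + 5) 2 (4 * t + 2) C₁ ×
        GoodLCD (6 * t + 5) 2 (4 * t + 2) C₂ ×
        ¬ Equivalent C₁ C₂ ×
        ((D : Code (6 * t + 5)) → GoodLCD (6 * t + 5) 2 (4 * t + 2) D →
          Equivalent D C₁ ⊎ Equivalent D C₂))
lemma4p6 = LCD-[6t+4,2,4t+2]-unique , LCD-[6t+5,2,4t+2]-two-classes
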